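{- Let $F_{\rm opt}$ be a forest produced by the bad-tree elimination procedure described in the context. Then $\lambda^*\ge w_{\max}(F_{\rm opt})$.
   Context: Setting: $G=(V,E)$ is a complete undirected graph and $w:E\to[0,\infty)$ is a metric (symmetric, triangle inequality). $D\subseteq V$ is the set of depots, $m=|D|$, $V^-=V\setminus D$, $k\ge m$ an integer. For a subgraph $H$, $\mathcal V(H)$, $\mathcal E(H)$ are its vertex and edge sets, $w(H)$ its total edge weight and $w_{\max}(H)=\max_{e\in\mathcal E(H)}w(e)$. A rooted cycle cover with at most $k$ cycles is a collection of at most $k$ pairwise edge-disjoint cycles of $G$, each containing exactly one depot, whose vertex sets cover $V$; $\lambda^*$ is the minimum over such covers of the maximum cycle weight, and $\mathscr C^*$ is a fixed cover attaining it. Forest $F^*$: merge all depots into a new vertex $\hat d$ with $w(\hat d,v)=\min_{d\in D}w(d,v)$ for $v\in V^-$; compute a minimum spanning tree of the complete graph on $V^-\cup\{\hat d\}$; replace each edge $(v,\hat d)$ by $(d^\star,v)$ with $d^\star\in\arg\min_{d\in D}w(d,v)$ (ties arbitrary), add the depots, delete $\hat d$. Edge set $E^\dagger$: starting from $F^*$, repeatedly add a minimum-weight edge of $E$ joining two distinct trees of the current forest and merge them, until one tree remains. A tree $T$ is heavy if $w(T)\ge\lambda^*$; light if $w(T)<\lambda^*$ and $\mathcal V(C)\subseteq\mathcal V(T)$ for some $C\in\mathscr C^*$; bad if $w(T)<\lambda^*$ and no $C\in\mathscr C^*$ has $\mathcal V(C)\subseteq\mathcal V(T)$. Bad-tree elimination: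 start with $F^*$; while a bad tree $T_b$ exists, pick a minimum-weight edge $(v,v')\in E^\dagger$ with $v\in\mathcal V(T_b)$, $v'\notin\mathcal V(T_b)$ and join $T_b$ with the tree containing $v'$ via this edge. $F_{\rm opt}$ is the resulting forest.
   Formalization: The edge weights $w$, and hence $\lambda^*$, are nonnegative rationals rather than nonnegative reals. -}

module Defs where

open import Data.Nat using (ℕ; zero; suc)
open import Data.Fin using (Fin)
open import Data.Fin.Subset using (Subset; _∈_; _∉_; ∣_∣)
open import Data.Rational using (ℚ; 0ℚ; _+_; _≤_; _<_; _⊔_)
open import Data.List using (List; []; _∷_; _++_; [_]; length; lookup; removeAt; mapMaybe; foldr; map)
open import Data.List.Relation.Unary.All using (All)
open import Data.List.Relation.Unary.Unique.Propositional using (Unique)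
import Data.List.Membership.Propositional as Mem
open import Data.Maybe using (Maybe; just; nothing)
open import Data.Product using (Σ; ∃; ∃-syntax; _×_; _,_; proj₁; proj₂)
open import Data.Sum using (_⊎_)
open import Data.Unit using (⊤)
open import Relation.Nullary using (¬_)
open import Relation.Binary.PropositionalEquality using (_≡_; _≢_)

EdgeIn : {A : Set} → List (A × A) → A → A → Set
EdgeIn F x y = Mem._∈_ (x , y) F ⊎ Mem._∈_ (y , x) F

data Connected {A : Set} (F : List (A × A)) (u : A) : A → Set where
  here : Connected F u u
  step : ∀ {x y} → Connected F u x → EdgeIn F x y → Connected F u y

-- no edge of F lies on a cycle: removing any one edge (occurrence)
-- disconnects its endpoints (this also excludes loops and parallel edges)
Acyclic : {A : Set} → List (A × A) → Set
Acyclic F = (i : Fin (length F)) →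
  ¬ Connected (removeAt F i) (proj₁ (lookup F i)) (proj₂ (lookup F i))

SameEdge : {A : Set} → A × A → A × A → Set
SameEdge (a , b) (c , d) = (a ≡ c × b ≡ d) ⊎ (a ≡ d × b ≡ c)

Weight : ℕ → Set
Weight n = Fin n → Fin n → ℚ

Edges : ℕ → Set
Edges n = List (Fin n × Fin n)

Metric : {n : ℕ} → Weight n → Set
Metric {n} w =
  (∀ u v → 0ℚ ≤ w u v) ×
  (∀ u → w u u ≡ 0ℚ) ×
  (∀ u v → w u v ≡ w v u) ×
  (∀ u v x → w u v ≤ w u x + w x v)

edgeW : {n : ℕ} → Weight n → Fin n × Fin n → ℚ
edgeW w (u , v) = w u v

sumℚ : List ℚ → ℚ
sumℚ = foldr _+_ 0ℚ

totalW : {n : ℕ} → Weight n → Edges n → ℚ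
totalW w F = sumℚ (map (edgeW w) F)

-- A cycle rooted at the depot `root`, visiting the distinct vertices
-- `inner` in order and returning to `root`.  (inner = [] is the trivial
-- cycle consisting of the depot alone; inner = [v] is d-v-d.)
record Cycle (n : ℕ) : Set where
  constructor cyc
  field
    root  : Fin n
    inner : List (Fin n)
open Cycle public

cverts : {n : ℕ} → Cycle n → List (Fin n)
cverts c = root c ∷ inner c

consecutive : {A : Set} → List A → List (A × A)
consecutive []           = []
consecutive (x ∷ [])     = []
consecutive (x ∷ y ∷ xs) = (x , y) ∷ consecutive (y ∷ xs)

cedges : {n : ℕ} → Cycle n → Edges n
cedges (cyc r [])       = []
cedges (cyc r (v ∷ vs)) = consecutive (r ∷ v ∷ vs ++ [ r ])

cycW : {n : ℕ} → Weight n → Cycle n → ℚ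
cycW w c = totalW w (cedges c)

ValidCycle : {n : ℕ} → Subset n → Cycle n → Set
ValidCycle D c = root c ∈ D × All (λ v → v ∉ D) (inner c) × Unique (inner c)

IsRCC : {n : ℕ} → Subset n → ℕ → List (Cycle n) → Set
IsRCC {n} D k C =
  All (ValidCycle D) C ×
  Data.Nat._≤_ (length C) k ×
  (∀ (i j : Fin (length C)) → i ≢ j →
     ∀ e e' → Mem._∈_ e (cedges (lookup C i)) → Mem._∈_ e' (cedges (lookup C j)) →
     ¬ SameEdge e e') ×
  (∀ (v : Fin n) → ∃[ c ] (Mem._∈_ c C × Mem._∈_ v (cverts c)))

-- maximum cycle weight of a cover (weights are ≥ 0, so 0 is a neutral start)
maxW : {n : ℕ} → Weight n → List (Cycle n) → ℚ
maxW w C = foldr (λ c acc → cycW w c ⊔ acc) 0ℚ C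

IsNearestDepot : {n : ℕ} → Weight n → Subset n → (Fin n → Fin n) → Set
IsNearestDepot {n} w D dstar =
  ∀ (v : Fin n) → v ∉ D → dstar v ∈ D × (∀ d → d ∈ D → w (dstar v) v ≤ w d v)

-- contracted graph: nothing = the merged depot d̂, just v for v ∈ V⁻
CVert : ℕ → Set
CVert n = Maybe (Fin n)

ValidCV : {n : ℕ} → Subset n → CVert n → Set
ValidCV D nothing  = ⊤
ValidCV D (just v) = v ∉ D

-- ŵ(d̂ , v) = min_{d ∈ D} w(d , v) = w(dstar v , v)
cW : {n : ℕ} → Weight n → (Fin n → Fin n) → CVert n → CVert n → ℚ
cW w dstar nothing  nothing  = 0ℚ
cW w dstar nothing  (just v) = w (dstar v) v
cW w dstar (just u) nothing  = w (dstar u) u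
cW w dstar (just u) (just v) = w u v

cTotalW : {n : ℕ} → Weight n → (Fin n → Fin n) → List (CVert n × CVert n) → ℚ
cTotalW w dstar T = sumℚ (map (λ e → cW w dstar (proj₁ e) (proj₂ e)) T)

SpanningTree : {n : ℕ} → Subset n → List (CVert n × CVert n) → Set
SpanningTree D T =
  All (λ e → ValidCV D (proj₁ e) × ValidCV D (proj₂ e)) T ×
  Acyclic T ×
  (∀ x → ValidCV D x → Connected T nothing x)

IsMST : {n : ℕ} → Weight n → Subset n → (Fin n → Fin n) → List (CVert n × CVert n) → Set
IsMST w D dstar T =
  SpanningTree D T × (∀ T' → SpanningTree D T' → cTotalW w dstar T ≤ cTotalW w dstar T')

-- replace (v , d̂) by (dstar v , v); delete d̂ (a loop at d̂ cannot occur)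
uncontract : {n : ℕ} → (Fin n → Fin n) → CVert n × CVert n → Maybe (Fin n × Fin n)
uncontract dstar (nothing , nothing) = nothing
uncontract dstar (nothing , just v)  = just (dstar v , v)
uncontract dstar (just u , nothing)  = just (u , dstar u)
uncontract dstar (just u , just v)   = just (u , v)

-- F* on vertex set Fin n (depots included as vertices)
Fstar : {n : ℕ} → (Fin n → Fin n) → List (CVert n × CVert n) → Edges n
Fstar dstar T = mapMaybe (uncontract dstar) T

-- E† : Kruskal-style completion of a forest F into one tree R (R = E†)

data KruskalExt {n : ℕ} (w : Weight n) : Edges n → Edges n → Set where
  done : ∀ {F} → (∀ u v → Connected F u v) → KruskalExt w F F
  step : ∀ {F R} (u v : Fin n) →
         ¬ Connected F u v →
         (∀ x y → ¬ Connected F x y → w u v ≤ w x y) →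
         KruskalExt w (F ++ [ (u , v) ]) R →
         KruskalExt w F R

data CompW {n : ℕ} (w : Weight n) (F : Edges n) (b : Fin n) : Edges n → ℚ → Set where
  nil : CompW w F b [] 0ℚ
  inT : ∀ {x y es W} → Connected F b x → CompW w F b es W →
        CompW w F b ((x , y) ∷ es) (w x y + W)
  outT : ∀ {x y es W} → ¬ Connected F b x → CompW w F b es W →
         CompW w F b ((x , y) ∷ es) W

TreeW : {n : ℕ} → Weight n → Edges n → Fin n → ℚ → Set
TreeW w F b W = CompW w F b F W

Bad : {n : ℕ} → Weight n → ℚ → List (Cycle n) → Edges n → Fin n → Set
Bad w lam Cs F b =
  (∃[ W ] (TreeW w F b W × W < lam)) ×
  ¬ (∃[ c ] (Mem._∈_ c Cs × All (Connected F b) (cverts c)))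

data BadElim {n : ℕ} (w : Weight n) (lam : ℚ) (Cs : List (Cycle n)) (Edag : Edges n)
       : Edges n → Edges n → Set where
  done : ∀ {F} → (∀ b → ¬ Bad w lam Cs F b) → BadElim w lam Cs Edag F F
  step : ∀ {F R} (b v v' : Fin n) →
         Bad w lam Cs F b →
         EdgeIn Edag v v' →
         Connected F b v → ¬ Connected F b v' →
         (∀ x y → EdgeIn Edag x y → Connected F b x → ¬ Connected F b y → w v v' ≤ w x y) →
         BadElim w lam Cs Edag (F ++ [ (v , v') ]) R →
         BadElim w lam Cs Edag F R

{-# OPTIONS --safe #-}
-- Every edge of a cycle of C* weighs at most λ* = maxW C*.  If an edge e of the minimum
-- spanning tree of the contracted graph were heavier, deleting e would cut some vertex x off
-- from d̂; along the cycle of C* from x to its depot some edge crosses the cut, it stays light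
-- after contraction, and it could replace e in a cheaper spanning tree.  So F* is light, and
-- then Kruskal's greedy completion joins the ends of every light edge by a light path of E†.
-- Finally, if bad-tree elimination left a bad tree T_b by an edge heavier than λ*, no light
-- edge of E† leaves T_b, so neither does a light path, nor the cycle of C* through a vertex
-- of T_b: then T_b would not be bad.
-- Connectivity is never decided; the arguments run under double negation, which is harmless
-- because every conclusion is an inequality of rationals.
module Submission where

open import Defs
open import Level using (0ℓ)
open import Data.Nat using (ℕ)
open import Data.Fin using (Fin; zero; suc)
open import Data.Fin.Subset using (Subset; ∣_∣; _∉_) renaming (_∈_ to _∈ₛ_)
open import Data.Fin.Subset.Properties using (_∈?_)
open import Data.Rational using (ℚ; 0ℚ; _+_; _≤_; _<_)
import Data.Rational.Properties as ℚ
open import Data.List using (List; []; _∷_; _++_; [_]; length; lookup; removeAt; map)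
open import Data.List.Membership.Propositional using (_∈_)
open import Data.List.Membership.Propositional.Properties using (∈-lookup; ∈-map⁺)
open import Data.List.Relation.Binary.Subset.Propositional using (_⊆_)
open import Data.List.Relation.Binary.Subset.Propositional.Properties
  using (⊆-refl; xs⊆x∷xs; ∷⁺ʳ; xs⊆xs++ys)
open import Data.List.Relation.Unary.All as All using (All; []; _∷_)
import Data.List.Relation.Unary.All.Properties as AllP
open import Data.List.Relation.Unary.Any using (here; there; index)
open import Data.List.Relation.Unary.Any.Properties using (lookup-index)
open import Data.Maybe using (Maybe; just; nothing)
import Data.Maybe.Relation.Unary.All as Maybe
open import Data.Product using (_×_; _,_; proj₁; proj₂; ∃-syntax)
import Data.Product as Product
open import Data.Sum using (_⊎_; inj₁; inj₂)
import Data.Sum as Sum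
open import Data.Unit using (tt)
open import Data.Empty using (⊥; ⊥-elim)
open import Function using (_∘_)
open import Effect.Monad using (RawMonad)
open import Relation.Nullary using (¬_; yes; no)
open import Relation.Nullary.Decidable using (¬¬-excluded-middle)
open import Relation.Nullary.Negation using (¬¬-Monad)
open import Relation.Binary.PropositionalEquality using (_≡_; refl; sym; trans; cong; subst)
open import Algebra.Bundles using (CommutativeMonoid)
open import Algebra.Properties.CommutativeSemigroup
  (CommutativeMonoid.commutativeSemigroup ℚ.+-0-commutativeMonoid) using (x∙yz≈y∙xz)

private variable
  A B : Set
  F G H : List (A × A)
  a a′ p q u v x y z : A

EdgeIn-sym : EdgeIn F x y → EdgeIn F y x
EdgeIn-sym (inj₁ xy) = inj₂ xy
EdgeIn-sym (inj₂ yx) = inj₁ yx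

EdgeIn-mono : F ⊆ G → EdgeIn F x y → EdgeIn G x y
EdgeIn-mono F⊆G (inj₁ xy) = inj₁ (F⊆G xy)
EdgeIn-mono F⊆G (inj₂ yx) = inj₂ (F⊆G yx)

Connected-edge : EdgeIn F x y → Connected F x y
Connected-edge = step here

Connected-trans : Connected F x y → Connected F y z → Connected F x z
Connected-trans xy here          = xy
Connected-trans xy (step yz′ e) = step (Connected-trans xy yz′) e

Connected-sym : Connected F x y → Connected F y x
Connected-sym here         = here
Connected-sym (step xy′ e) = Connected-trans (Connected-edge (EdgeIn-sym e)) (Connected-sym xy′)

Connected-mono : F ⊆ G → Connected F x y → Connected G x y
Connected-mono F⊆G here         = here
Connected-mono F⊆G (step xy′ e) = step (Connected-mono F⊆G xy′) (EdgeIn-mono F⊆G e)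

Connected-closed : (P : A → Set) → (∀ {x y} → EdgeIn F x y → P x → P y) →
                   Connected F x y → P x → P y
Connected-closed P closed here         px = px
Connected-closed P closed (step xy′ e) px = closed e (Connected-closed P closed xy′ px)

ConnectedVia : List (A × A) → A × A → A → A → Set
ConnectedVia F (a , a′) u v =
  Connected F u v ⊎ (Connected F u a × Connected F a′ v) ⊎ (Connected F u a′ × Connected F a v)

private
  ConnectedVia-step : ConnectedVia F (a , a′) u x → EdgeIn F x y → ConnectedVia F (a , a′) u y
  ConnectedVia-step via e =
    Sum.map (λ c → step c e) (Sum.map (Product.map₂ (λ c → step c e)) (Product.map₂ (λ c → step c e)))
            via

Connected-∷⁻ : Connected ((a , a′) ∷ F) u v → ConnectedVia F (a , a′) u v
Connected-∷⁻ here = inj₁ here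
Connected-∷⁻ (step c (inj₁ (here refl))) with Connected-∷⁻ c
... | inj₁ ua               = inj₂ (inj₁ (ua , here))
... | inj₂ (inj₁ (ua , _))  = inj₂ (inj₁ (ua , here))
... | inj₂ (inj₂ (ua′ , _)) = inj₁ ua′
Connected-∷⁻ (step c (inj₂ (here refl))) with Connected-∷⁻ c
... | inj₁ ua′              = inj₂ (inj₂ (ua′ , here))
... | inj₂ (inj₁ (ua , _))  = inj₁ ua
... | inj₂ (inj₂ (ua′ , _)) = inj₂ (inj₂ (ua′ , here))
Connected-∷⁻ (step c (inj₁ (there xy))) = ConnectedVia-step (Connected-∷⁻ c) (inj₁ xy)
Connected-∷⁻ (step c (inj₂ (there yx))) = ConnectedVia-step (Connected-∷⁻ c) (inj₂ yx)

Connected-consecutive : (y : A) (ys : List A) → z ∈ y ∷ ys → Connected (consecutive (y ∷ ys)) y z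
Connected-consecutive y ys        (here refl) = here
Connected-consecutive y []        (there ())
Connected-consecutive y (y′ ∷ ys) (there z∈) =
  Connected-trans (Connected-edge (inj₁ (here refl)))
                  (Connected-mono (xs⊆x∷xs _ _) (Connected-consecutive y′ ys z∈))

Connected-cycle : ∀ {n} (c : Cycle n) {z : Fin n} → z ∈ cverts c → Connected (cedges c) (root c) z
Connected-cycle (cyc r [])       (here refl) = here
Connected-cycle (cyc r [])       (there ())
Connected-cycle (cyc r (v ∷ vs)) z∈          =
  Connected-consecutive r (v ∷ vs ++ [ r ]) (∷⁺ʳ r (xs⊆xs++ys (v ∷ vs) [ r ]) z∈)

¬¬-All : {P : A → Set} {xs : List A} → All (λ x → ¬ ¬ P x) xs → ¬ ¬ All P xs
¬¬-All = All.sequenceA 0ℓ (RawMonad.rawApplicative ¬¬-Monad)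

removeAt-⊆ : (xs : List B) (i : Fin (length xs)) → removeAt xs i ⊆ xs
removeAt-⊆ (x ∷ xs) zero    = xs⊆x∷xs xs x
removeAt-⊆ (x ∷ xs) (suc i) = ∷⁺ʳ x (removeAt-⊆ xs i)

⊆-lookup∷removeAt : (xs : List B) (i : Fin (length xs)) → xs ⊆ lookup xs i ∷ removeAt xs i
⊆-lookup∷removeAt (x ∷ xs) zero    x∈          = x∈
⊆-lookup∷removeAt (x ∷ xs) (suc i) (here refl) = there (here refl)
⊆-lookup∷removeAt (x ∷ xs) (suc i) (there y∈) with ⊆-lookup∷removeAt xs i y∈
... | here eq  = here eq
... | there y∈′ = there (there y∈′)

removeAt-removeAt : (xs : List B) (i : Fin (length xs)) (j : Fin (length (removeAt xs i))) →
  ∃[ k ] (lookup xs k ≡ lookup (removeAt xs i) j × removeAt (removeAt xs i) j ⊆ removeAt xs k)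
removeAt-removeAt (x ∷ xs) zero    j       = suc j , refl , xs⊆x∷xs _ x
removeAt-removeAt (x ∷ xs) (suc i) zero    = zero , refl , removeAt-⊆ xs i
removeAt-removeAt (x ∷ xs) (suc i) (suc j) with removeAt-removeAt xs i j
... | k , eq , ⊆k = suc k , eq , ∷⁺ʳ x ⊆k

Acyclic-removeAt : Acyclic F → (i : Fin (length F)) → Acyclic (removeAt F i)
Acyclic-removeAt {F = F} acyclic i j c with removeAt-removeAt F i j
... | k , eq , ⊆k =
  acyclic k (subst (λ e → Connected (removeAt F k) (proj₁ e) (proj₂ e)) (sym eq) (Connected-mono ⊆k c))

Acyclic-∷ : Acyclic F → ¬ Connected F p q → Acyclic ((p , q) ∷ F)
Acyclic-∷ acyclic ¬pq zero = ¬pq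
Acyclic-∷ {F = F} {p = p} {q = q} acyclic ¬pq (suc j) c = refute (Connected-∷⁻ c)
  where
  lift : Connected (removeAt F j) x y → Connected F x y
  lift = Connected-mono (removeAt-⊆ F j)
  g₁g₂ : Connected F (proj₁ (lookup F j)) (proj₂ (lookup F j))
  g₁g₂ = Connected-edge (inj₁ (∈-lookup j))
  refute : ConnectedVia (removeAt F j) (p , q) (proj₁ (lookup F j)) (proj₂ (lookup F j)) → ⊥
  refute (inj₁ g₁g₂′)              = acyclic j g₁g₂′
  refute (inj₂ (inj₁ (g₁p , qg₂))) =
    ¬pq (Connected-trans (Connected-sym (lift g₁p)) (Connected-trans g₁g₂ (Connected-sym (lift qg₂))))
  refute (inj₂ (inj₂ (g₁q , pg₂))) =
    ¬pq (Connected-trans (lift pg₂) (Connected-trans (Connected-sym g₁g₂) (lift g₁q)))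

Connected-removeAt : (F : List (A × A)) (i : Fin (length F)) →
  Connected F (proj₁ (lookup F i)) v →
  Connected (removeAt F i) (proj₁ (lookup F i)) v ⊎ Connected (removeAt F i) (proj₂ (lookup F i)) v
Connected-removeAt F i c with Connected-∷⁻ (Connected-mono (⊆-lookup∷removeAt F i) c)
... | inj₁ av               = inj₁ av
... | inj₂ (inj₁ (_ , a′v)) = inj₂ a′v
... | inj₂ (inj₂ (_ , av))  = inj₁ av

Connected-∷-bridge : (V : A → Set) → (∀ {z} → V z → Connected H a z ⊎ Connected H a′ z) →
  V p → V q → ¬ Connected H p q → V z → Connected ((p , q) ∷ H) a z
Connected-∷-bridge {H = H} {a = a} {a′ = a′} {p = p} {q = q} {z = z} V sides vp vq ¬pq vz = join (sides vz)
  where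
  lift : Connected H x y → Connected ((p , q) ∷ H) x y
  lift = Connected-mono (xs⊆x∷xs H (p , q))
  pq : Connected ((p , q) ∷ H) p q
  pq = Connected-edge (inj₁ (here refl))
  aa′ : Connected ((p , q) ∷ H) a a′
  aa′ with sides vp | sides vq
  ... | inj₁ ap  | inj₁ aq  = ⊥-elim (¬pq (Connected-trans (Connected-sym ap) aq))
  ... | inj₂ a′p | inj₂ a′q = ⊥-elim (¬pq (Connected-trans (Connected-sym a′p) a′q))
  ... | inj₁ ap  | inj₂ a′q = Connected-trans (lift ap) (Connected-trans pq (Connected-sym (lift a′q)))
  ... | inj₂ a′p | inj₁ aq  =
    Connected-trans (lift aq) (Connected-trans (Connected-sym pq) (Connected-sym (lift a′p)))
  join : Connected H a z ⊎ Connected H a′ z → Connected ((p , q) ∷ H) a z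
  join (inj₁ az)  = lift az
  join (inj₂ a′z) = Connected-trans aa′ (lift a′z)

sumℚ-removeAt : (f : B → ℚ) (xs : List B) (i : Fin (length xs)) →
  sumℚ (map f xs) ≡ f (lookup xs i) + sumℚ (map f (removeAt xs i))
sumℚ-removeAt f (x ∷ xs) zero    = refl
sumℚ-removeAt f (x ∷ xs) (suc i) =
  trans (cong (f x +_) (sumℚ-removeAt f xs i))
        (x∙yz≈y∙xz (f x) (f (lookup xs i)) (sumℚ (map f (removeAt xs i))))

sumℚ-nonneg : {xs : List ℚ} → All (0ℚ ≤_) xs → 0ℚ ≤ sumℚ xs
sumℚ-nonneg []                   = ℚ.≤-refl
sumℚ-nonneg {x ∷ xs} (0≤x ∷ 0≤xs) = begin
  0ℚ            ≡⟨ sym (ℚ.+-identityʳ 0ℚ) ⟩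
  0ℚ + 0ℚ       ≤⟨ ℚ.+-mono-≤ 0≤x (sumℚ-nonneg 0≤xs) ⟩
  x + sumℚ xs   ∎
  where open ℚ.≤-Reasoning

∈⇒≤sumℚ : {xs : List ℚ} {x : ℚ} → All (0ℚ ≤_) xs → x ∈ xs → x ≤ sumℚ xs
∈⇒≤sumℚ {x ∷ xs} (_ ∷ 0≤xs) (here refl) = begin
  x             ≡⟨ sym (ℚ.+-identityʳ x) ⟩
  x + 0ℚ        ≤⟨ ℚ.+-monoʳ-≤ x (sumℚ-nonneg 0≤xs) ⟩
  x + sumℚ xs   ∎
  where open ℚ.≤-Reasoning
∈⇒≤sumℚ {y ∷ xs} {x} (0≤y ∷ 0≤xs) (there x∈) = begin
  x             ≤⟨ ∈⇒≤sumℚ 0≤xs x∈ ⟩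
  sumℚ xs       ≡⟨ sym (ℚ.+-identityˡ (sumℚ xs)) ⟩
  0ℚ + sumℚ xs  ≤⟨ ℚ.+-monoˡ-≤ (sumℚ xs) 0≤y ⟩
  y + sumℚ xs   ∎
  where open ℚ.≤-Reasoning

edgeW≤totalW : ∀ {n} {w : Weight n} → (∀ u v → 0ℚ ≤ w u v) →
  {e : Fin n × Fin n} {F : Edges n} → e ∈ F → edgeW w e ≤ totalW w F
edgeW≤totalW {w = w} nonneg e∈ =
  ∈⇒≤sumℚ (AllP.map⁺ (All.universal (λ e → nonneg (proj₁ e) (proj₂ e)) _)) (∈-map⁺ (edgeW w) e∈)

cycW≤maxW : ∀ {n} (w : Weight n) {c : Cycle n} {Cs : List (Cycle n)} → c ∈ Cs → cycW w c ≤ maxW w Cs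
cycW≤maxW w (here refl)               = ℚ.p≤p⊔q _ _
cycW≤maxW w {Cs = c′ ∷ Cs} (there c∈) = ℚ.≤-trans (cycW≤maxW w c∈) (ℚ.p≤q⊔p (cycW w c′) _)

module Contraction {n : ℕ} {w : Weight n} (metric : Metric w)
                   {D : Subset n} {dstar : Fin n → Fin n} (nearest : IsNearestDepot w D dstar) where

  private
    w-sym : ∀ u v → w u v ≡ w v u
    w-sym = proj₁ (proj₂ (proj₂ metric))

  cw : CVert n × CVert n → ℚ
  cw e = cW w dstar (proj₁ e) (proj₂ e)

  contract : Fin n → CVert n
  contract v with v ∈? D
  ... | yes _ = nothing
  ... | no _  = just v

  contract-valid : (v : Fin n) → ValidCV D (contract v)
  contract-valid v with v ∈? D
  ... | yes _  = tt
  ... | no v∉D = v∉D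

  contract-depot : {v : Fin n} → v ∈ₛ D → contract v ≡ nothing
  contract-depot {v} v∈D with v ∈? D
  ... | yes _  = refl
  ... | no v∉D = ⊥-elim (v∉D v∈D)

  contract-nondepot : {v : Fin n} → v ∉ D → contract v ≡ just v
  contract-nondepot {v} v∉D with v ∈? D
  ... | yes v∈D = ⊥-elim (v∉D v∈D)
  ... | no _    = refl

  cw-contract≤w : (u v : Fin n) → cw (contract u , contract v) ≤ w u v
  cw-contract≤w u v with u ∈? D | v ∈? D
  ... | yes _   | yes _   = proj₁ metric u v
  ... | yes u∈D | no v∉D  = proj₂ (nearest v v∉D) u u∈D
  ... | no u∉D  | yes v∈D = subst (w (dstar u) u ≤_) (w-sym v u) (proj₂ (nearest u u∉D) v v∈D)
  ... | no _    | no _    = ℚ.≤-refl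

  module MinimumSpanningTree {T : List (CVert n × CVert n)} (mst : IsMST w D dstar T) where

    T-valid : All (λ e → ValidCV D (proj₁ e) × ValidCV D (proj₂ e)) T
    T-valid = proj₁ (proj₁ mst)

    T-acyclic : Acyclic T
    T-acyclic = proj₁ (proj₂ (proj₁ mst))

    T-spans : ∀ x → ValidCV D x → Connected T nothing x
    T-spans = proj₂ (proj₂ (proj₁ mst))

    cut-property : (i : Fin (length T)) {p q : CVert n} → ValidCV D p → ValidCV D q →
      ¬ Connected (removeAt T i) p q → cw (lookup T i) ≤ cw (p , q)
    cut-property i {p} {q} vp vq ¬pq = ℚ.≮⇒≥ exchange-not-cheaper
      where
      T⁻ : List (CVert n × CVert n)
      T⁻ = removeAt T i
      e₁ e₂ : CVert n
      e₁ = proj₁ (lookup T i)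
      e₂ = proj₂ (lookup T i)
      sides : {z : CVert n} → ValidCV D z → Connected T⁻ e₁ z ⊎ Connected T⁻ e₂ z
      sides vz = Connected-removeAt T i
        (Connected-trans (Connected-sym (T-spans e₁ (proj₁ (All.lookup T-valid (∈-lookup i)))))
                         (T-spans _ vz))
      joins : {z : CVert n} → ValidCV D z → Connected ((p , q) ∷ T⁻) e₁ z
      joins = Connected-∷-bridge (ValidCV D) sides vp vq ¬pq
      exchange : SpanningTree D ((p , q) ∷ T⁻)
      exchange = (vp , vq) ∷ AllP.anti-mono (removeAt-⊆ T i) T-valid
               , Acyclic-∷ (Acyclic-removeAt {F = T} T-acyclic i) ¬pq
               , λ z vz → Connected-trans (Connected-sym (joins tt)) (joins vz)
      exchange-not-cheaper : ¬ (cw (p , q) < cw (lookup T i))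
      exchange-not-cheaper pq<e = ℚ.<-irrefl refl (ℚ.≤-<-trans (proj₂ mst _ exchange) (begin-strict
        cw (p , q) + cTotalW w dstar T⁻        <⟨ ℚ.+-monoˡ-< (cTotalW w dstar T⁻) pq<e ⟩
        cw (lookup T i) + cTotalW w dstar T⁻   ≡⟨ sym (sumℚ-removeAt cw T i) ⟩
        cTotalW w dstar T                     ∎))
        where open ℚ.≤-Reasoning

module LightEdges {n : ℕ} {w : Weight n} (metric : Metric w) (lam : ℚ) where

  private
    w-sym : ∀ u v → w u v ≡ w v u
    w-sym = proj₁ (proj₂ (proj₂ metric))

  Light : Fin n × Fin n → Set
  Light e = edgeW w e ≤ lam

  EdgeIn-light : {F : Edges n} {x y : Fin n} → All Light F → EdgeIn F x y → w x y ≤ lam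
  EdgeIn-light light (inj₁ xy) = All.lookup light xy
  EdgeIn-light light (inj₂ yx) = subst (_≤ lam) (w-sym _ _) (All.lookup light yx)

  LightlyConnected : Edges n → Fin n → Fin n → Set
  LightlyConnected R x y = ∃[ G ] (G ⊆ R × All Light G × Connected G x y)

  KruskalExt-⊆ : {F R : Edges n} → KruskalExt w F R → F ⊆ R
  KruskalExt-⊆ (done _)           = ⊆-refl
  KruskalExt-⊆ (step _ _ _ _ ext) = KruskalExt-⊆ ext ∘ xs⊆xs++ys _ _

  KruskalExt-lightlyConnected : {F R : Edges n} → KruskalExt w F R → All Light F →
    {x y : Fin n} → w x y ≤ lam → ¬ ¬ LightlyConnected R x y
  KruskalExt-lightlyConnected {F} (done connected) light _ ¬lc = ¬lc (F , ⊆-refl , light , connected _ _)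
  KruskalExt-lightlyConnected {F} ext@(step _ _ _ cheapest ext′) light {x} {y} xy≤ ¬lc =
    ¬¬-excluded-middle λ where
      (yes xy) → ¬lc (F , KruskalExt-⊆ ext , light , xy)
      (no ¬xy) → KruskalExt-lightlyConnected ext′
                   (AllP.++⁺ light (ℚ.≤-trans (cheapest x y ¬xy) xy≤ ∷ [])) xy≤ ¬lc

  module _ {Cs : List (Cycle n)} (covers : ∀ v → ∃[ c ] (c ∈ Cs × v ∈ cverts c))
           (cycles-light : ∀ {c} → c ∈ Cs → All Light (cedges c)) where

    cycle-closed : (P : Fin n → Set) → (∀ {x y} → w x y ≤ lam → P x → P y) →
      {c : Cycle n} → c ∈ Cs → {x y : Fin n} → x ∈ cverts c → y ∈ cverts c → P x → P y
    cycle-closed P closed {c} c∈ x∈ y∈ =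
      Connected-closed P (λ e → closed (EdgeIn-light (cycles-light c∈) e))
        (Connected-trans (Connected-sym (Connected-cycle c x∈)) (Connected-cycle c y∈))

    module _ {Edag : Edges n} (light-paths : ∀ {x y} → w x y ≤ lam → ¬ ¬ LightlyConnected Edag x y) where

      no-light-exit⇒closed : (S : Fin n → Set) →
        (∀ {x y} → EdgeIn Edag x y → S x → ¬ S y → lam < w x y) →
        {x y : Fin n} → w x y ≤ lam → ¬ ¬ S x → ¬ ¬ S y
      no-light-exit⇒closed S exits-heavy xy≤ ¬¬sx ¬sy = light-paths xy≤ λ (G , G⊆ , light , xy) →
        ¬¬sx (Connected-closed (λ z → ¬ S z) (stays-outside G⊆ light) (Connected-sym xy) ¬sy)
        where
        stays-outside : {G : Edges n} → G ⊆ Edag → All Light G →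
          {s t : Fin n} → EdgeIn G s t → ¬ S s → ¬ S t
        stays-outside G⊆ light st ¬ss s-t = ℚ.<-irrefl refl
          (ℚ.<-≤-trans (exits-heavy (EdgeIn-mono G⊆ (EdgeIn-sym st)) s-t ¬ss)
                       (EdgeIn-light light (EdgeIn-sym st)))

      BadElim-light : {F R : Edges n} → BadElim w lam Cs Edag F R → All Light F → All Light R
      BadElim-light (done _)                                  light = light
      BadElim-light {F} (step b v v′ bad _ _ _ cheapest elim) light =
        BadElim-light elim (AllP.++⁺ light (ℚ.≮⇒≥ exit-not-heavy ∷ []))
        where
        exit-not-heavy : ¬ (lam < w v v′)
        exit-not-heavy lam<vv′ with covers b
        ... | c , c∈ , b∈ =
          ¬¬-All (All.tabulate λ z∈ →
                    cycle-closed (λ z → ¬ ¬ Connected F b z) tree-closed c∈ b∈ z∈ (λ ¬bb → ¬bb here))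
                 (λ inside → proj₂ bad (c , c∈ , inside))
          where
          tree-closed : {x y : Fin n} → w x y ≤ lam → ¬ ¬ Connected F b x → ¬ ¬ Connected F b y
          tree-closed = no-light-exit⇒closed (Connected F b)
            (λ e bx ¬by → ℚ.<-≤-trans lam<vv′ (cheapest _ _ e bx ¬by))

    module _ {D : Subset n} {dstar : Fin n → Fin n} (nearest : IsNearestDepot w D dstar)
             (roots : ∀ {c} → c ∈ Cs → root c ∈ₛ D) where

      open Contraction metric nearest

      uncontract-light : {e : CVert n × CVert n} → cw e ≤ lam → Maybe.All Light (uncontract dstar e)
      uncontract-light {nothing , nothing} _  = Maybe.nothing
      uncontract-light {nothing , just v}  le = Maybe.just le
      uncontract-light {just u  , nothing} le = Maybe.just (subst (_≤ lam) (w-sym (dstar u) u) le)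
      uncontract-light {just u  , just v}  le = Maybe.just le

      module _ {T : List (CVert n × CVert n)} (mst : IsMST w D dstar T) where
        open MinimumSpanningTree mst

        connected-to-d̂ : (i : Fin (length T)) → lam < cw (lookup T i) →
          (s : CVert n) → ValidCV D s → ¬ ¬ Connected (removeAt T i) s nothing
        connected-to-d̂ i lam<e nothing  _   ¬s-d̂ = ¬s-d̂ here
        connected-to-d̂ i lam<e (just x) x∉D ¬x-d̂ with covers x
        ... | c , c∈ , x∈ = x-cut-off here
          where
          P : Fin n → Set
          P v = ¬ Connected (removeAt T i) (just x) (contract v)
          light-cut : {u v : Fin n} → w u v ≤ lam → P u → P v
          light-cut {u} {v} uv≤ ¬xu xv = ℚ.<-irrefl refl (ℚ.<-≤-trans lam<e (begin
            cw (lookup T i)               ≤⟨ cut-property i (contract-valid v) (contract-valid u)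
                                               (λ vu → ¬xu (Connected-trans xv vu)) ⟩
            cw (contract v , contract u)  ≤⟨ cw-contract≤w v u ⟩
            w v u                         ≤⟨ subst (_≤ lam) (w-sym u v) uv≤ ⟩
            lam                           ∎))
            where open ℚ.≤-Reasoning
          root-cut-off : P (root c)
          root-cut-off =
            subst (λ s → ¬ Connected (removeAt T i) (just x) s) (sym (contract-depot (roots c∈))) ¬x-d̂
          x-cut-off : ¬ Connected (removeAt T i) (just x) (just x)
          x-cut-off = subst (λ s → ¬ Connected (removeAt T i) (just x) s) (contract-nondepot x∉D)
            (cycle-closed P light-cut c∈ (here refl) x∈ root-cut-off)

        MST-light : (i : Fin (length T)) → cw (lookup T i) ≤ lam
        MST-light i = ℚ.≮⇒≥ λ lam<e →
          connected-to-d̂ i lam<e _ (proj₁ ends) λ e₁-d̂ →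
          connected-to-d̂ i lam<e _ (proj₂ ends) λ e₂-d̂ →
          T-acyclic i (Connected-trans e₁-d̂ (Connected-sym e₂-d̂))
          where
          ends : ValidCV D (proj₁ (lookup T i)) × ValidCV D (proj₂ (lookup T i))
          ends = All.lookup T-valid (∈-lookup i)

        Fstar-light : All Light (Fstar dstar T)
        Fstar-light = AllP.mapMaybe⁺ {xs = T} {f = uncontract dstar} (AllP.gmap⁺ uncontract-light T-light)
          where
          T-light : All (λ e → cw e ≤ lam) T
          T-light = All.tabulate λ e∈ →
            subst (λ e → cw e ≤ lam) (sym (lookup-index e∈)) (MST-light (index e∈))

lemma6 : ∀ {n : ℕ} (w : Weight n) → Metric w →
    (D : Subset n) (k : ℕ) → Data.Nat._≤_ ∣ D ∣ k →
    (lamStar : ℚ) (Cstar : List (Cycle n)) →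
    IsRCC D k Cstar → lamStar ≡ maxW w Cstar →
    (∀ C → IsRCC D k C → lamStar ≤ maxW w C) →
    (dstar : Fin n → Fin n) → IsNearestDepot w D dstar →
    (That : List (Maybe (Fin n) × Maybe (Fin n))) → IsMST w D dstar That →
    (Edag : Edges n) → KruskalExt w (Fstar dstar That) Edag →
    (Fopt : Edges n) → BadElim w lamStar Cstar Edag (Fstar dstar That) Fopt →
    ∀ u v → (u , v) ∈ Fopt → w u v ≤ lamStar
lemma6 w metric D _ _ .(maxW w Cs) Cs rcc refl _ dstar nearest T mst _ kruskal _ elim _ _ uv∈ =
  All.lookup (BadElim-light covers cycles-light light-paths elim F*-light) uv∈
  where
  open LightEdges metric (maxW w Cs)
  covers : ∀ v → ∃[ c ] (c ∈ Cs × v ∈ cverts c)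
  covers = proj₂ (proj₂ (proj₂ rcc))
  cycles-light : {c : Cycle _} → c ∈ Cs → All Light (cedges c)
  cycles-light c∈ = All.tabulate λ e∈ → ℚ.≤-trans (edgeW≤totalW (proj₁ metric) e∈) (cycW≤maxW w c∈)
  roots : {c : Cycle _} → c ∈ Cs → root c ∈ₛ D
  roots c∈ = proj₁ (All.lookup (proj₁ rcc) c∈)
  F*-light : All Light (Fstar dstar T)
  F*-light = Fstar-light covers cycles-light nearest roots mst
  light-paths : ∀ {x y} → w x y ≤ maxW w Cs → ¬ ¬ LightlyConnected _ x y
  light-paths = KruskalExt-lightlyConnected kruskal F*-light
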